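{- For every integer $n\ge1$, the polynomials $A_n(x;u,d)$ satisfy $$A_n(x;u,d)=\big[1+(n-1)\big(d+(1+u)x\big)\big]A_{n-1}(x;u,d)+(x-x^2)\frac{\partial}{\partial x}A_{n-1}(x;u,d),$$ with $A_0(x;u,d)=1$.
   Context: A tile is a positive integer $m$ together with a marker that is absent ($m$), an up-arrow ($m\!\uparrow$) or a down-arrow ($m\!\downarrow$). For $n\ge1$ the set $\mathrm{GS}_n$ of generalized permutations of $[n]$ consists of words of tiles, each with an ascent set $\mathrm{asc}(\pi)$, defined recursively. $\mathrm{GS}_1$ contains only the word consisting of the unmarked tile $1$, with $\mathrm{asc}=\emptyset$. For $n\ge2$, $\mathrm{GS}_n$ consists of all words $\pi'$ obtained from some $\pi=\pi_1\cdots\pi_{n-1}\in\mathrm{GS}_{n-1}$ by one of: (i) insert the unmarked tile $n$ into gap $j$, $0\le j\le n-1$, i.e. $\pi'=\pi_1\cdots\pi_j\, n\,\pi_{j+1}\cdots\pi_{n-1}$; if $j=0$ then $\mathrm{asc}(\pi')=\{a+1: a\in\mathrm{asc}(\pi)\}$, and if $1\le j\le n-1$ then $\mathrm{asc}(\pi')=\{a\in\mathrm{asc}(\pi): a<j\}\cup\{j\}\cup\{a+1: a\in\mathrm{asc}(\pi),\ a>j\}$; (ii) insert $n\!\uparrow$ immediately left of $\pi_i$, $1\le i\le n-1$; then $\mathrm{asc}(\pi')=\{a\in\mathrm{asc}(\pi): a<i\}\cup\{i\}\cup\{a+1: a\in\mathrm{asc}(\pi), a\ge i\}$; (iii) insert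 $n\!\downarrow$ immediately left of $\pi_i$, $1\le i\le n-1$; then $\mathrm{asc}(\pi')=\{a\in\mathrm{asc}(\pi): a<i\}\cup\{a+1: a\in\mathrm{asc}(\pi), a\ge i\}$. For $\pi\in\mathrm{GS}_n$ let $\mathrm{nua}(\pi)$, $\mathrm{nda}(\pi)$ be the numbers of up-arrow and down-arrow tiles of $\pi$. Define $A(n,k;u,d)=\sum u^{\mathrm{nua}(\pi)}d^{\mathrm{nda}(\pi)}$ over all $\pi\in\mathrm{GS}_n$ with $|\mathrm{asc}(\pi)|=k$, and for $n\ge1$ let $A_n(x;u,d)=\sum_{k=0}^{n-1}A(n,k;u,d)x^k$; set $A_0(x;u,d)=1$. -}

module Defs where

open import Data.Nat as ℕ using (ℕ; zero; suc; _<?_; _≤?_; _≟_; _∸_)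
open import Data.Integer as ℤ using (ℤ; +_)
open import Data.Bool using (Bool; true; false; if_then_else_; _∧_)
open import Data.List using (List; []; _∷_; _++_; map; filter; concatMap; upTo; length)
open import Data.Product using (_×_; _,_; proj₁; proj₂)
open import Relation.Nullary.Decidable using (⌊_⌋)
open import Relation.Binary.PropositionalEquality using (_≡_)

data Marker : Set where
  none up down : Marker

Tile : Set
Tile = ℕ × Marker

-- a generalized permutation together with its ascent set (as a list of
-- positions; the recursive construction never produces repetitions)
GP : Set
GP = List Tile × List ℕ

insertAt : ℕ → Tile → List Tile → List Tile
insertAt zero    t w        = t ∷ w
insertAt (suc j) t []       = t ∷ []
insertAt (suc j) t (x ∷ w)  = x ∷ insertAt j t w

ascI : ℕ → List ℕ → List ℕ
ascI zero asc = map suc asc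
ascI j    asc = filter (λ a → a <? j) asc ++ (j ∷ map suc (filter (λ a → j <? a) asc))

ascUp : ℕ → List ℕ → List ℕ
ascUp i asc = filter (λ a → a <? i) asc ++ (i ∷ map suc (filter (λ a → i ≤? a) asc))

ascDown : ℕ → List ℕ → List ℕ
ascDown i asc = filter (λ a → a <? i) asc ++ map suc (filter (λ a → i ≤? a) asc)

step : ℕ → GP → List GP
step n (w , asc) =
     map (λ j → insertAt j (n , none) w , ascI j asc) (upTo n)
  ++ map (λ i → insertAt (i ∸ 1) (n , up) w , ascUp i asc) (map suc (upTo (n ∸ 1)))
  ++ map (λ i → insertAt (i ∸ 1) (n , down) w , ascDown i asc) (map suc (upTo (n ∸ 1)))

-- GS n  (meaningful for n ≥ 1; GS 0 is unused and empty)
GS : ℕ → List GP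
GS zero = []
GS (suc zero) = (((1 , none) ∷ []) , []) ∷ []
GS (suc (suc m)) = concatMap (step (suc (suc m))) (GS (suc m))

isUp : Tile → Bool
isUp (_ , up) = true
isUp _        = false

isDown : Tile → Bool
isDown (_ , down) = true
isDown _          = false

countB : {A : Set} → (A → Bool) → List A → ℕ
countB p [] = 0
countB p (x ∷ xs) = if p x then suc (countB p xs) else countB p xs

nua : GP → ℕ
nua (w , _) = countB isUp w

nda : GP → ℕ
nda (w , _) = countB isDown w

nasc : GP → ℕ
nasc (_ , asc) = length asc

-- Polynomials in x, u, d with integer coefficients, given by their
-- coefficient functions:  p k a b  = coefficient of x^k u^a d^b.

Poly : Set
Poly = ℕ → ℕ → ℕ → ℤ

_≈P_ : Poly → Poly → Set
p ≈P q = ∀ k a b → p k a b ≡ q k a b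

infix 4 _≈P_
infixl 6 _+P_ _-P_
infixl 7 _*P_

constP : ℤ → Poly
constP c zero zero zero = c
constP c _ _ _ = + 0

oneP : Poly
oneP = constP (+ 1)

X U D : Poly
X (suc zero) zero zero = + 1
X _ _ _ = + 0
U zero (suc zero) zero = + 1
U _ _ _ = + 0
D zero zero (suc zero) = + 1
D _ _ _ = + 0

_+P_ : Poly → Poly → Poly
(p +P q) k a b = p k a b ℤ.+ q k a b

_-P_ : Poly → Poly → Poly
(p -P q) k a b = p k a b ℤ.- q k a b

sumTo : ℕ → (ℕ → ℤ) → ℤ
sumTo zero f = f 0
sumTo (suc n) f = sumTo n f ℤ.+ f (suc n)

_*P_ : Poly → Poly → Poly
(p *P q) k a b =
  sumTo k λ i → sumTo a λ j → sumTo b λ l →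
    p i j l ℤ.* q (k ∸ i) (a ∸ j) (b ∸ l)

∂x : Poly → Poly
∂x p k a b = + (suc k) ℤ.* p (suc k) a b

countGS : ℕ → ℕ → ℕ → ℕ → ℕ
countGS n k a b =
  countB (λ π → ⌊ nasc π ≟ k ⌋ ∧ ⌊ nua π ≟ a ⌋ ∧ ⌊ nda π ≟ b ⌋) (GS n)

Apoly : ℕ → Poly
Apoly zero = oneP
Apoly (suc m) k a b = if ⌊ k <? suc m ⌋ then + countGS (suc m) k a b else + 0

module Submission where

-- Let R_n p be the right-hand side with A_n replaced by p.  R_n is linear
-- (R-+, R-zero) and on monomials (R-mono)
--   R_n(x^k u^a d^b) = (1+k) x^k u^a d^b + n x^k u^a d^{b+1}
--                      + (n-k) x^{k+1} u^a d^b + n x^{k+1} u^{a+1} d^b,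
-- which is the generating function of the children in GS_{n+1} of a word
-- of GS_n with k ascents, a up- and b down-arrows (children-genFun): gap 0
-- and the k gaps in asc(π) keep k ascents, the other n-k gaps add one, and
-- the n up-arrow (down-arrow) insertions add an ascent and an up-arrow (a
-- down-arrow).  Counting the gaps needs asc(π) to be strictly increasing
-- in [1, n-1] (ValidAsc, GS-valid).  Summing over GS_n gives the theorem
-- for n ≥ 1 (genFun-children, Apoly-genFun); n = 0 is a direct check.

open import Defs
open import Data.Nat as ℕ using (ℕ; zero; suc; _≤_; _<_; z≤n; s≤s; _∸_; _<?_; _≤?_)
import Data.Nat.Properties as ℕP
open import Data.Integer using (ℤ; +_; _+_; _*_; _-_; -1ℤ)
import Data.Integer.Properties as ℤP
open import Data.Integer.Tactic.RingSolver using (solve-∀)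
open import Data.Nat.ListAction using (sum)
open import Data.Bool using (Bool; true; false; if_then_else_; _∧_)
open import Data.List using (List; []; _∷_; _++_; map; filter; upTo; applyUpTo; length; concatMap)
import Data.List.Properties as ListP
open import Data.List.Relation.Unary.All as All using (All; []; _∷_)
import Data.List.Relation.Unary.All.Properties as AllP
open import Data.Product using (_×_; _,_; proj₂)
open import Data.Sum using (_⊎_; inj₁; inj₂)
open import Function using (_∘_)
open import Relation.Nullary using (yes; no; contradiction)
open import Relation.Nullary.Decidable using (⌊_⌋)
open import Relation.Unary using (Pred; Decidable)
open import Relation.Binary using (tri<; tri≈; tri>)
open import Relation.Binary.PropositionalEquality
open import Relation.Binary.Bundles using (Setoid)
import Relation.Binary.Reasoning.Setoid as SetoidReasoning
open import Algebra.Properties.CommutativeSemigroup ℕP.+-commutativeSemigroup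
  using () renaming (interchange to ℕ-interchange)
open import Algebra.Properties.CommutativeSemigroup ℤP.+-commutativeSemigroup
  using () renaming (interchange to ℤ-interchange)

-- The indicator  [i = j] ∈ {0, 1}, by recursion so that it computes on
-- successors.
ind : ℕ → ℕ → ℕ
ind zero    zero    = 1
ind zero    (suc j) = 0
ind (suc i) zero    = 0
ind (suc i) (suc j) = ind i j

ind-refl : ∀ i → ind i i ≡ 1
ind-refl zero    = refl
ind-refl (suc i) = ind-refl i

ind-≢ : ∀ {i j} → i ≢ j → ind i j ≡ 0
ind-≢ {zero}  {zero}  i≢j = contradiction refl i≢j
ind-≢ {zero}  {suc j} _   = refl
ind-≢ {suc i} {zero}  _   = refl
ind-≢ {suc i} {suc j} i≢j = ind-≢ (i≢j ∘ cong suc)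

ind-sym : ∀ i j → ind i j ≡ ind j i
ind-sym zero    zero    = refl
ind-sym zero    (suc j) = refl
ind-sym (suc i) zero    = refl
ind-sym (suc i) (suc j) = ind-sym i j

ind-+ : ∀ i j m → ind (i ℕ.+ j) (i ℕ.+ m) ≡ ind j m
ind-+ zero    j m = refl
ind-+ (suc i) j m = ind-+ i j m

sumTo-cong : ∀ n {f g : ℕ → ℤ} → (∀ i → f i ≡ g i) → sumTo n f ≡ sumTo n g
sumTo-cong zero    f≡g = f≡g 0
sumTo-cong (suc n) f≡g = cong₂ _+_ (sumTo-cong n f≡g) (f≡g (suc n))

sumTo-+ : ∀ n (f g : ℕ → ℤ) → sumTo n (λ i → f i + g i) ≡ sumTo n f + sumTo n g
sumTo-+ zero    f g = refl
sumTo-+ (suc n) f g =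
  trans (cong (_+ (f (suc n) + g (suc n))) (sumTo-+ n f g))
        (ℤ-interchange (sumTo n f) (sumTo n g) (f (suc n)) (g (suc n)))

sumTo-*ˡ : ∀ n c (f : ℕ → ℤ) → sumTo n (λ i → c * f i) ≡ c * sumTo n f
sumTo-*ˡ zero    c f = refl
sumTo-*ˡ (suc n) c f =
  trans (cong (_+ c * f (suc n)) (sumTo-*ˡ n c f))
        (sym (ℤP.*-distribˡ-+ c (sumTo n f) (f (suc n))))

sumTo-*ʳ : ∀ n c (f : ℕ → ℤ) → sumTo n (λ i → f i * c) ≡ sumTo n f * c
sumTo-*ʳ n c f =
  trans (sumTo-cong n (λ i → ℤP.*-comm (f i) c))
        (trans (sumTo-*ˡ n c f) (ℤP.*-comm c (sumTo n f)))

sumTo-zero : ∀ n → sumTo n (λ _ → + 0) ≡ + 0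
sumTo-zero zero    = refl
sumTo-zero (suc n) = cong (_+ + 0) (sumTo-zero n)

δ : ℕ → ℕ → ℤ
δ i j = + ind i j

δ-refl : ∀ i → δ i i ≡ + 1
δ-refl i = cong +_ (ind-refl i)

δ-≢ : ∀ {i j} → i ≢ j → δ i j ≡ + 0
δ-≢ i≢j = cong +_ (ind-≢ i≢j)

δ-≢-term : ∀ {i j} (z : ℤ) → i ≢ j → δ i j * z ≡ + 0
δ-≢-term z i≢j = cong (_* z) (δ-≢ i≢j)

sumTo-δ-above : ∀ n i (f : ℕ → ℤ) → n < i → sumTo n (λ j → δ i j * f j) ≡ + 0
sumTo-δ-above zero    i f 0<i = δ-≢-term (f 0) (ℕP.>⇒≢ 0<i)
sumTo-δ-above (suc n) i f n<i =
  cong₂ _+_ (sumTo-δ-above n i f (ℕP.<-trans (ℕP.n<1+n n) n<i))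
            (δ-≢-term (f (suc n)) (ℕP.>⇒≢ n<i))

sumTo-δ : ∀ n i (f : ℕ → ℤ) → i ≤ n → sumTo n (λ j → δ i j * f j) ≡ f i
sumTo-δ zero .zero f z≤n = ℤP.*-identityˡ (f 0)
sumTo-δ (suc n) i f i≤1+n with ℕP.m≤n⇒m<n∨m≡n i≤1+n
... | inj₁ i<1+n =
  trans (cong₂ _+_ (sumTo-δ n i f (ℕP.≤-pred i<1+n)) (δ-≢-term (f (suc n)) (ℕP.<⇒≢ i<1+n)))
        (ℤP.+-identityʳ (f i))
... | inj₂ refl =
  trans (cong₂ _+_ (sumTo-δ-above n (suc n) f (ℕP.n<1+n n))
                   (cong (_* f (suc n)) (δ-refl (suc n))))
        (trans (ℤP.+-identityˡ _) (ℤP.*-identityˡ (f (suc n))))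

Σ³ : ℕ → ℕ → ℕ → (ℕ → ℕ → ℕ → ℤ) → ℤ
Σ³ k a b F = sumTo k λ i → sumTo a λ j → sumTo b λ l → F i j l

Σ³-cong : ∀ k a b {F G : ℕ → ℕ → ℕ → ℤ} →
  (∀ i j l → F i j l ≡ G i j l) → Σ³ k a b F ≡ Σ³ k a b G
Σ³-cong k a b F≡G =
  sumTo-cong k λ i → sumTo-cong a λ j → sumTo-cong b λ l → F≡G i j l

Σ³-+ : ∀ k a b (F G : ℕ → ℕ → ℕ → ℤ) →
  Σ³ k a b (λ i j l → F i j l + G i j l) ≡ Σ³ k a b F + Σ³ k a b G
Σ³-+ k a b F G =
  trans (sumTo-cong k λ i → trans (sumTo-cong a λ j → sumTo-+ b (F i j) (G i j))
                                  (sumTo-+ a _ _))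
        (sumTo-+ k _ _)

Σ³-*ˡ : ∀ k a b c (F : ℕ → ℕ → ℕ → ℤ) →
  Σ³ k a b (λ i j l → c * F i j l) ≡ c * Σ³ k a b F
Σ³-*ˡ k a b c F =
  trans (sumTo-cong k λ i → trans (sumTo-cong a λ j → sumTo-*ˡ b c (F i j))
                                  (sumTo-*ˡ a c _))
        (sumTo-*ˡ k c _)

Σ³-zero : ∀ k a b → Σ³ k a b (λ _ _ _ → + 0) ≡ + 0
Σ³-zero k a b =
  trans (sumTo-cong k λ i → trans (sumTo-cong a λ j → sumTo-zero b) (sumTo-zero a))
        (sumTo-zero k)

-- Coefficientwise equality, wrapped in a record so that the polynomials
-- can be inferred from the type of a proof.
infix 4 _≈_
record _≈_ (p q : Poly) : Set where
  constructor ⟨_⟩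
  field coeff : p ≈P q
open _≈_

polySetoid : Setoid _ _
polySetoid = record
  { Carrier       = Poly
  ; _≈_           = _≈_
  ; isEquivalence = record
    { refl  = ⟨ (λ k a b → refl) ⟩
    ; sym   = λ p≈q → ⟨ (λ k a b → sym (coeff p≈q k a b)) ⟩
    ; trans = λ p≈q q≈r → ⟨ (λ k a b → trans (coeff p≈q k a b) (coeff q≈r k a b)) ⟩
    }
  }

open Setoid polySetoid public using ()
  renaming (refl to ≈-refl; reflexive to ≈-reflexive; sym to ≈-sym; trans to ≈-trans)

zeroP : Poly
zeroP _ _ _ = + 0

infixr 8 _•_
_•_ : ℤ → Poly → Poly
(c • p) k a b = c * p k a b

+P-cong : ∀ {p p′ q q′} → p ≈ p′ → q ≈ q′ → p +P q ≈ p′ +P q′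
+P-cong p≈p′ q≈q′ = ⟨ (λ k a b → cong₂ _+_ (coeff p≈p′ k a b) (coeff q≈q′ k a b)) ⟩

-P-cong : ∀ {p p′ q q′} → p ≈ p′ → q ≈ q′ → p -P q ≈ p′ -P q′
-P-cong p≈p′ q≈q′ = ⟨ (λ k a b → cong₂ _-_ (coeff p≈p′ k a b) (coeff q≈q′ k a b)) ⟩

•-cong : ∀ c {p p′} → p ≈ p′ → c • p ≈ c • p′
•-cong c p≈p′ = ⟨ (λ k a b → cong (c *_) (coeff p≈p′ k a b)) ⟩

*P-cong : ∀ {p p′ q q′} → p ≈ p′ → q ≈ q′ → p *P q ≈ p′ *P q′
*P-cong p≈p′ q≈q′ = ⟨ (λ k a b → Σ³-cong k a b λ i j l →
  cong₂ _*_ (coeff p≈p′ i j l) (coeff q≈q′ (k ∸ i) (a ∸ j) (b ∸ l))) ⟩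

∂x-cong : ∀ {p p′} → p ≈ p′ → ∂x p ≈ ∂x p′
∂x-cong p≈p′ = ⟨ (λ k a b → cong (+ suc k *_) (coeff p≈p′ (suc k) a b)) ⟩

*P-distribʳ : ∀ p q r → (p +P q) *P r ≈ p *P r +P q *P r
*P-distribʳ p q r = ⟨ (λ k a b →
  trans (Σ³-cong k a b λ i j l → ℤP.*-distribʳ-+ (r (k ∸ i) (a ∸ j) (b ∸ l)) (p i j l) (q i j l))
        (Σ³-+ k a b _ _)) ⟩

*P-distribˡ : ∀ p q r → r *P (p +P q) ≈ r *P p +P r *P q
*P-distribˡ p q r = ⟨ (λ k a b →
  trans (Σ³-cong k a b λ i j l → ℤP.*-distribˡ-+ (r i j l) _ _)
        (Σ³-+ k a b _ _)) ⟩

*P-•ˡ : ∀ c p q → (c • p) *P q ≈ c • (p *P q)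
*P-•ˡ c p q = ⟨ (λ k a b →
  trans (Σ³-cong k a b λ i j l → ℤP.*-assoc c (p i j l) _) (Σ³-*ˡ k a b c _)) ⟩

*P-•ʳ : ∀ c p q → p *P (c • q) ≈ c • (p *P q)
*P-•ʳ c p q = ⟨ (λ k a b →
  trans (Σ³-cong k a b λ i j l → pull c (p i j l) _) (Σ³-*ˡ k a b c _)) ⟩
  where
  pull : ∀ (c x y : ℤ) → x * (c * y) ≡ c * (x * y)
  pull = solve-∀

*P-zeroʳ : ∀ p → p *P zeroP ≈ zeroP
*P-zeroʳ p = ⟨ (λ k a b →
  trans (Σ³-cong k a b λ i j l → ℤP.*-zeroʳ (p i j l)) (Σ³-zero k a b)) ⟩

-P-as-+P : ∀ p q → p -P q ≈ p +P -1ℤ • q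
-P-as-+P p q = ⟨ (λ k a b → cong (λ t → p k a b + t) (sym (ℤP.-1*i≡-i (q k a b)))) ⟩

∂x-+ : ∀ p q → ∂x (p +P q) ≈ ∂x p +P ∂x q
∂x-+ p q = ⟨ (λ k a b → ℤP.*-distribˡ-+ (+ suc k) (p (suc k) a b) (q (suc k) a b)) ⟩

∂x-zero : ∂x zeroP ≈ zeroP
∂x-zero = ⟨ (λ k a b → ℤP.*-zeroʳ (+ suc k)) ⟩

mono : ℕ → ℕ → ℕ → Poly
mono i j l k a b = δ i k * δ j a * δ l b

δ-convolution : ∀ i i′ k → sumTo k (λ x → δ i x * δ i′ (k ∸ x)) ≡ δ (i ℕ.+ i′) k
δ-convolution i i′ k with i ℕ.≤? k
... | yes i≤k =
  trans (sumTo-δ k i (λ x → δ i′ (k ∸ x)) i≤k)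
        (trans (cong +_ (sym (ind-+ i i′ (k ∸ i))))
               (cong (δ (i ℕ.+ i′)) (ℕP.m+[n∸m]≡n i≤k)))
... | no i≰k =
  trans (sumTo-δ-above k i _ (ℕP.≰⇒> i≰k))
        (sym (δ-≢ (λ i+i′≡k → i≰k (subst (i ≤_) i+i′≡k (ℕP.m≤m+n i i′)))))

Σ³-separable : ∀ k a b (F G H : ℕ → ℤ) →
  Σ³ k a b (λ x y z → F x * (G y * H z)) ≡ sumTo k F * (sumTo a G * sumTo b H)
Σ³-separable k a b F G H =
  trans (sumTo-cong k λ x →
           trans (sumTo-cong a λ y → sumTo-*ˡ b (F x) (λ z → G y * H z))
                 (trans (sumTo-*ˡ a (F x) _) (cong (F x *_) (product a b G H))))
        (sumTo-*ʳ k _ F)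
  where
  product : ∀ m n (f g : ℕ → ℤ) →
    sumTo m (λ y → sumTo n (λ z → f y * g z)) ≡ sumTo m f * sumTo n g
  product m n f g = trans (sumTo-cong m λ y → sumTo-*ˡ n (f y) g) (sumTo-*ʳ m (sumTo n g) f)

mono-* : ∀ i j l i′ j′ l′ →
  mono i j l *P mono i′ j′ l′ ≈ mono (i ℕ.+ i′) (j ℕ.+ j′) (l ℕ.+ l′)
mono-* i j l i′ j′ l′ = ⟨ coeffs ⟩
  where
  regroup : ∀ (a b c d e f : ℤ) → (a * b * c) * (d * e * f) ≡ (a * d) * ((b * e) * (c * f))
  regroup = solve-∀
  coeffs : mono i j l *P mono i′ j′ l′ ≈P mono (i ℕ.+ i′) (j ℕ.+ j′) (l ℕ.+ l′)
  coeffs k a b = begin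
      Σ³ k a b (λ x y z → (δ i x * δ j y * δ l z) * (δ i′ (k ∸ x) * δ j′ (a ∸ y) * δ l′ (b ∸ z)))
    ≡⟨ Σ³-cong k a b (λ x y z → regroup (δ i x) (δ j y) (δ l z) _ _ _) ⟩
      Σ³ k a b (λ x y z → Dx x * (Dy y * Dz z))
    ≡⟨ Σ³-separable k a b Dx Dy Dz ⟩
      sumTo k Dx * (sumTo a Dy * sumTo b Dz)
    ≡⟨ cong₂ _*_ (δ-convolution i i′ k) (cong₂ _*_ (δ-convolution j j′ a) (δ-convolution l l′ b)) ⟩
      δ (i ℕ.+ i′) k * (δ (j ℕ.+ j′) a * δ (l ℕ.+ l′) b)
    ≡⟨ ℤP.*-assoc (δ (i ℕ.+ i′) k) _ _ ⟨
      mono (i ℕ.+ i′) (j ℕ.+ j′) (l ℕ.+ l′) k a b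
    ∎
    where
    open ≡-Reasoning
    Dx Dy Dz : ℕ → ℤ
    Dx x = δ i x * δ i′ (k ∸ x)
    Dy y = δ j y * δ j′ (a ∸ y)
    Dz z = δ l z * δ l′ (b ∸ z)

*P-identityˡ : ∀ p → mono 0 0 0 *P p ≈ p
*P-identityˡ p = ⟨ (λ k a b →
  trans (sumTo-cong k λ x → trans (sumTo-cong a λ y → inner k a b x y) (pick a (δ 0 x) _))
        (sumTo-δ k 0 _ z≤n)) ⟩
  where
  pick : ∀ a c (f : ℕ → ℤ) → sumTo a (λ y → c * (δ 0 y * f y)) ≡ c * f 0
  pick a c f = trans (sumTo-*ˡ a c _) (cong (c *_) (sumTo-δ a 0 f z≤n))
  inner : ∀ k a b x y →
    sumTo b (λ z → δ 0 x * δ 0 y * δ 0 z * p (k ∸ x) (a ∸ y) (b ∸ z))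
      ≡ δ 0 x * (δ 0 y * p (k ∸ x) (a ∸ y) b)
  inner k a b x y =
    trans (sumTo-cong b λ z → ℤP.*-assoc (δ 0 x * δ 0 y) (δ 0 z) _)
          (trans (pick b (δ 0 x * δ 0 y) _) (ℤP.*-assoc (δ 0 x) (δ 0 y) _))

X≈mono : X ≈ mono 1 0 0
X≈mono = ⟨ coeffs ⟩
  where
  coeffs : X ≈P mono 1 0 0
  coeffs zero                a       b       = refl
  coeffs (suc zero)          zero    zero    = refl
  coeffs (suc zero)          zero    (suc b) = refl
  coeffs (suc zero)          (suc a) b       = refl
  coeffs (suc (suc k))       a       b       = refl

U≈mono : U ≈ mono 0 1 0
U≈mono = ⟨ coeffs ⟩
  where
  coeffs : U ≈P mono 0 1 0
  coeffs zero    zero          b       = refl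
  coeffs zero    (suc zero)    zero    = refl
  coeffs zero    (suc zero)    (suc b) = refl
  coeffs zero    (suc (suc a)) b       = refl
  coeffs (suc k) a             b       = refl

D≈mono : D ≈ mono 0 0 1
D≈mono = ⟨ coeffs ⟩
  where
  coeffs : D ≈P mono 0 0 1
  coeffs zero    zero    zero          = refl
  coeffs zero    zero    (suc zero)    = refl
  coeffs zero    zero    (suc (suc b)) = refl
  coeffs zero    (suc a) b             = refl
  coeffs (suc k) a       b             = refl

constP≈mono : ∀ c → constP c ≈ c • mono 0 0 0
constP≈mono c = ⟨ coeffs ⟩
  where
  coeffs : constP c ≈P c • mono 0 0 0
  coeffs zero    zero    zero    = sym (ℤP.*-identityʳ c)
  coeffs zero    zero    (suc b) = sym (ℤP.*-zeroʳ c)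
  coeffs zero    (suc a) b       = sym (ℤP.*-zeroʳ c)
  coeffs (suc k) a       b       = sym (ℤP.*-zeroʳ c)

oneP≈mono : oneP ≈ mono 0 0 0
oneP≈mono = ≈-trans (constP≈mono (+ 1)) ⟨ (λ k a b → ℤP.*-identityˡ (mono 0 0 0 k a b)) ⟩

∂x-mono : ∀ k a b → ∂x (mono k a b) ≈ (+ k) • mono (k ∸ 1) a b
∂x-mono zero    a b = ⟨ (λ k′ a′ b′ → ℤP.*-zeroʳ (+ suc k′)) ⟩
∂x-mono (suc k) a b = ⟨ coeffs ⟩
  where
  vanish : ∀ {k′} c (y z : ℤ) → k ≢ k′ → c * (δ k k′ * y * z) ≡ + 0
  vanish c y z k≢k′ = trans (cong (λ t → c * (t * y * z)) (δ-≢ k≢k′)) (ℤP.*-zeroʳ c)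
  coeffs : ∂x (mono (suc k) a b) ≈P (+ suc k) • mono k a b
  coeffs k′ a′ b′ with k ℕ.≟ k′
  ... | yes refl = refl
  ... | no k≢k′  = trans (vanish (+ suc k′) _ _ k≢k′) (sym (vanish (+ suc k) _ _ k≢k′))

*P-distribʳ--P : ∀ p q r → (p -P q) *P r ≈ p *P r -P q *P r
*P-distribʳ--P p q r = begin
    (p -P q) *P r                 ≈⟨ *P-cong (-P-as-+P p q) (≈-refl {r}) ⟩
    (p +P -1ℤ • q) *P r           ≈⟨ *P-distribʳ p (-1ℤ • q) r ⟩
    p *P r +P (-1ℤ • q) *P r      ≈⟨ +P-cong (≈-refl {p *P r}) (*P-•ˡ -1ℤ q r) ⟩
    p *P r +P -1ℤ • (q *P r)      ≈⟨ -P-as-+P (p *P r) (q *P r) ⟨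
    p *P r -P q *P r              ∎
  where open SetoidReasoning polySetoid

x-x²∂x-mono : ∀ k a b →
  (X -P X *P X) *P ∂x (mono k a b) ≈ (+ k) • mono k a b -P (+ k) • mono (suc k) a b
x-x²∂x-mono k a b = begin
    (X -P X *P X) *P ∂x (mono k a b)
  ≈⟨ *P-cong (-P-cong X≈mono (≈-trans (*P-cong X≈mono X≈mono) (mono-* 1 0 0 1 0 0))) (∂x-mono k a b) ⟩
    (mono 1 0 0 -P mono 2 0 0) *P ((+ k) • m)
  ≈⟨ *P-•ʳ (+ k) (mono 1 0 0 -P mono 2 0 0) m ⟩
    (+ k) • ((mono 1 0 0 -P mono 2 0 0) *P m)
  ≈⟨ •-cong (+ k) (≈-trans (*P-distribʳ--P (mono 1 0 0) (mono 2 0 0) m)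
                          (-P-cong (mono-* 1 0 0 (k ∸ 1) a b) (mono-* 2 0 0 (k ∸ 1) a b))) ⟩
    (+ k) • (mono (suc (k ∸ 1)) a b -P mono (suc (suc (k ∸ 1))) a b)
  ≈⟨ shift k ⟩
    (+ k) • mono k a b -P (+ k) • mono (suc k) a b
  ∎
  where
  open SetoidReasoning polySetoid
  m : Poly
  m = mono (k ∸ 1) a b
  -- for k = 0 both sides vanish; otherwise suc (k ∸ 1) = k
  shift : ∀ k → (+ k) • (mono (suc (k ∸ 1)) a b -P mono (suc (suc (k ∸ 1))) a b)
                 ≈ (+ k) • mono k a b -P (+ k) • mono (suc k) a b
  shift zero    = ⟨ (λ _ _ _ → refl) ⟩
  shift (suc k) = ⟨ (λ k′ a′ b′ →
    distrib (+ suc k) (mono (suc k) a b k′ a′ b′) (mono (suc (suc k)) a b k′ a′ b′)) ⟩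
    where
    distrib : ∀ (c y z : ℤ) → c * (y - z) ≡ c * y - c * z
    distrib = solve-∀

constP-*P : ∀ c p → constP c *P p ≈ c • p
constP-*P c p =
  ≈-trans (*P-cong (constP≈mono c) (≈-refl {p}))
          (≈-trans (*P-•ˡ c (mono 0 0 0) p) (•-cong c (*P-identityˡ p)))

factor : ℕ → Poly
factor n = oneP +P constP (+ n) *P (D +P (oneP +P U) *P X)

R : ℕ → Poly → Poly
R n p = factor n *P p +P (X -P X *P X) *P ∂x p

R-cong : ∀ n {p q} → p ≈ q → R n p ≈ R n q
R-cong n p≈q =
  +P-cong (*P-cong (≈-refl {factor n}) p≈q) (*P-cong (≈-refl {X -P X *P X}) (∂x-cong p≈q))

R-+ : ∀ n p q → R n (p +P q) ≈ R n p +P R n q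
R-+ n p q = begin
    factor n *P (p +P q) +P x-x² *P ∂x (p +P q)
  ≈⟨ +P-cong (*P-distribˡ p q (factor n))
             (≈-trans (*P-cong (≈-refl {x-x²}) (∂x-+ p q)) (*P-distribˡ (∂x p) (∂x q) x-x²)) ⟩
    (factor n *P p +P factor n *P q) +P (x-x² *P ∂x p +P x-x² *P ∂x q)
  ≈⟨ ⟨ (λ k a b → ℤ-interchange ((factor n *P p) k a b) _ _ _) ⟩ ⟩
    R n p +P R n q
  ∎
  where
  open SetoidReasoning polySetoid
  x-x² : Poly
  x-x² = X -P X *P X

R-zero : ∀ n → R n zeroP ≈ zeroP
R-zero n =
  ≈-trans (+P-cong (*P-zeroʳ (factor n))
                   (≈-trans (*P-cong (≈-refl {X -P X *P X}) ∂x-zero) (*P-zeroʳ (X -P X *P X))))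
          ⟨ (λ _ _ _ → refl) ⟩

Y : Poly
Y = mono 0 0 1 +P (mono 1 0 0 +P mono 1 1 0)

Y-normal : D +P (oneP +P U) *P X ≈ Y
Y-normal =
  +P-cong D≈mono
    (≈-trans (*P-cong (+P-cong oneP≈mono U≈mono) X≈mono)
      (≈-trans (*P-distribʳ (mono 0 0 0) (mono 0 1 0) (mono 1 0 0))
               (+P-cong (mono-* 0 0 0 1 0 0) (mono-* 0 1 0 1 0 0))))

factor-mono : ∀ n k a b → factor n *P mono k a b ≈
  mono k a b +P (+ n) • (mono k a (suc b) +P (mono (suc k) a b +P mono (suc k) (suc a) b))
factor-mono n k a b = begin
    factor n *P m
  ≈⟨ *P-cong (+P-cong oneP≈mono (≈-trans (constP-*P (+ n) _) (•-cong (+ n) Y-normal))) (≈-refl {m}) ⟩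
    (mono 0 0 0 +P (+ n) • Y) *P m
  ≈⟨ *P-distribʳ (mono 0 0 0) ((+ n) • Y) m ⟩
    mono 0 0 0 *P m +P ((+ n) • Y) *P m
  ≈⟨ +P-cong (*P-identityˡ m) (*P-•ˡ (+ n) Y m) ⟩
    m +P (+ n) • (Y *P m)
  ≈⟨ +P-cong (≈-refl {m}) (•-cong (+ n) Y-times-m) ⟩
    m +P (+ n) • (mono k a (suc b) +P (mono (suc k) a b +P mono (suc k) (suc a) b))
  ∎
  where
  open SetoidReasoning polySetoid
  m : Poly
  m = mono k a b
  Y-times-m : Y *P m ≈ mono k a (suc b) +P (mono (suc k) a b +P mono (suc k) (suc a) b)
  Y-times-m =
    ≈-trans (*P-distribʳ (mono 0 0 1) _ m)
      (+P-cong (mono-* 0 0 1 k a b)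
        (≈-trans (*P-distribʳ (mono 1 0 0) (mono 1 1 0) m)
                 (+P-cong (mono-* 1 0 0 k a b) (mono-* 1 1 0 k a b))))

-- The image of a monomial under R_n; combinatorially, the generating
-- function of the children of a word with k ascents, a up- and b
-- down-arrows.
children : ℕ → ℕ → ℕ → ℕ → Poly
children n k a b =
  (+ suc k) • mono k a b +P (+ n) • mono k a (suc b)
    +P (+ n - + k) • mono (suc k) a b +P (+ n) • mono (suc k) (suc a) b

R-mono : ∀ n k a b → R n (mono k a b) ≈ children n k a b
R-mono n k a b =
  ≈-trans (+P-cong (factor-mono n k a b) (x-x²∂x-mono k a b))
          ⟨ (λ k′ a′ b′ → collect (+ n) (+ k) (mono k a b k′ a′ b′) (mono k a (suc b) k′ a′ b′)
                                  (mono (suc k) a b k′ a′ b′) (mono (suc k) (suc a) b k′ a′ b′)) ⟩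
  where
  collect : ∀ (n k m md mx mxu : ℤ) →
    (m + n * (md + (mx + mxu))) + (k * m - k * mx) ≡ (+ 1 + k) * m + n * md + (n - k) * mx + n * mxu
  collect = solve-∀

cnt : ℕ → List ℕ → ℕ
cnt x []       = 0
cnt x (y ∷ ys) = ind x y ℕ.+ cnt x ys

cnt-absent : ∀ {x} ys → All (x ≢_) ys → cnt x ys ≡ 0
cnt-absent []       []           = refl
cnt-absent (y ∷ ys) (x≢y ∷ x∉ys) = cong₂ ℕ._+_ (ind-≢ x≢y) (cnt-absent ys x∉ys)

cnt-map-suc : ∀ x ys → cnt (suc x) (map suc ys) ≡ cnt x ys
cnt-map-suc x []       = refl
cnt-map-suc x (y ∷ ys) = cong (ind x y ℕ.+_) (cnt-map-suc x ys)

cnt-upTo : ∀ n a → a < n → cnt a (upTo n) ≡ 1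
cnt-upTo (suc n) zero    _   = cong suc (cnt-absent (applyUpTo suc n) (AllP.applyUpTo⁺₂ suc n (λ _ ())))
cnt-upTo (suc n) (suc a) a<n =
  trans (cong (cnt (suc a)) (sym (ListP.map-upTo suc n)))
        (trans (cnt-map-suc a (upTo n)) (cnt-upTo n a (ℕP.≤-pred a<n)))

double-count : ∀ xs ys → sum (map (λ y → cnt y xs) ys) ≡ sum (map (λ x → cnt x ys) xs)
double-count []       ys = sum-zeros ys
  where
  sum-zeros : ∀ ys → sum (map (λ _ → 0) ys) ≡ 0
  sum-zeros []       = refl
  sum-zeros (_ ∷ ys) = sum-zeros ys
double-count (x ∷ xs) ys =
  trans (sum-map-+ ys) (cong₂ ℕ._+_ (indicator-sum ys) (double-count xs ys))
  where
  indicator-sum : ∀ ys → sum (map (λ y → ind y x) ys) ≡ cnt x ys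
  indicator-sum []       = refl
  indicator-sum (y ∷ ys) = cong₂ ℕ._+_ (ind-sym y x) (indicator-sum ys)
  sum-map-+ : ∀ ys → sum (map (λ y → ind y x ℕ.+ cnt y xs) ys)
                     ≡ sum (map (λ y → ind y x) ys) ℕ.+ sum (map (λ y → cnt y xs) ys)
  sum-map-+ []       = refl
  sum-map-+ (y ∷ ys) =
    trans (cong (ind y x ℕ.+ cnt y xs ℕ.+_) (sum-map-+ ys)) (ℕ-interchange (ind y x) _ _ _)

sum-≤-length : ∀ {A : Set} (f : A → ℕ) → (∀ y → f y ≤ 1) → ∀ ys → sum (map f ys) ≤ length ys
sum-≤-length f f≤1 []       = z≤n
sum-≤-length f f≤1 (y ∷ ys) = ℕP.+-mono-≤ (f≤1 y) (sum-≤-length f f≤1 ys)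

sum-ones : ∀ {A : Set} (f : A → ℕ) {ys} → All (λ y → f y ≡ 1) ys → sum (map f ys) ≡ length ys
sum-ones f []           = refl
sum-ones f (fy≡1 ∷ f≡1) = cong₂ ℕ._+_ fy≡1 (sum-ones f f≡1)

data Sorted : ℕ → List ℕ → Set where
  []  : ∀ {lo} → Sorted lo []
  _∷_ : ∀ {lo x L} → lo < x → Sorted x L → Sorted lo (x ∷ L)

sorted-weaken : ∀ {lo lo′ L} → lo′ ≤ lo → Sorted lo L → Sorted lo′ L
sorted-weaken lo′≤lo []           = []
sorted-weaken lo′≤lo (lo<x ∷ s) = ℕP.≤-<-trans lo′≤lo lo<x ∷ s

sorted-above : ∀ {lo L} → Sorted lo L → All (lo <_) L
sorted-above []         = []
sorted-above (lo<x ∷ s) = lo<x ∷ All.map (ℕP.<-trans lo<x) (sorted-above s)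

sorted-cnt≤1 : ∀ {lo L} j → Sorted lo L → cnt j L ≤ 1
sorted-cnt≤1 j [] = z≤n
sorted-cnt≤1 {L = x ∷ L} j (_ ∷ s) with j ℕ.≟ x
... | yes refl = ℕP.≤-reflexive
  (trans (cong (ind j j ℕ.+_) (cnt-absent L (All.map ℕP.<⇒≢ (sorted-above s))))
         (trans (ℕP.+-identityʳ _) (ind-refl j)))
... | no j≢x   = subst (λ t → t ℕ.+ cnt j L ≤ 1) (sym (ind-≢ j≢x)) (sorted-cnt≤1 j s)

sorted-map-suc : ∀ {lo L} → Sorted lo L → Sorted (suc lo) (map suc L)
sorted-map-suc []         = []
sorted-map-suc (lo<x ∷ s) = s≤s lo<x ∷ sorted-map-suc s

sorted-++ : ∀ {lo m A B} → Sorted lo A → All (_≤ m) A → lo ≤ m → Sorted m B → Sorted lo (A ++ B)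
sorted-++ []           []             lo≤m sB = sorted-weaken lo≤m sB
sorted-++ (lo<x ∷ sA) (x≤m ∷ A≤m) _    sB = lo<x ∷ sorted-++ sA A≤m x≤m sB

module _ {p} {P : Pred ℕ p} (P? : Decidable P) where

  sorted-filter : ∀ {lo L} → Sorted lo L → Sorted lo (filter P? L)
  sorted-filter [] = []
  sorted-filter {L = x ∷ L} (lo<x ∷ s) with P? x
  ... | yes _ = lo<x ∷ sorted-filter s
  ... | no _  = sorted-weaken (ℕP.<⇒≤ lo<x) (sorted-filter s)

  sorted-filter-above : ∀ {j lo L} → (∀ {a} → P a → j < a) → Sorted lo L → Sorted j (filter P? L)
  sorted-filter-above P⇒j< [] = []
  sorted-filter-above {L = x ∷ L} P⇒j< (_ ∷ s) with P? x
  ... | yes Px = P⇒j< Px ∷ sorted-filter s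
  ... | no _   = sorted-filter-above P⇒j< s

length-split : ∀ i L → length (filter (_<? i) L) ℕ.+ length (filter (i ≤?_) L) ≡ length L
length-split i [] = refl
length-split i (x ∷ L) with x <? i
... | yes x<i rewrite ListP.filter-accept (_<? i) {x} {L} x<i
                    | ListP.filter-reject (i ≤?_) {x} {L} (ℕP.<⇒≱ x<i) = cong suc (length-split i L)
... | no x≮i  rewrite ListP.filter-reject (_<? i) {x} {L} x≮i
                    | ListP.filter-accept (i ≤?_) {x} {L} (ℕP.≮⇒≥ x≮i) =
  trans (ℕP.+-suc _ _) (cong suc (length-split i L))

length-split₃ : ∀ j L →
  length (filter (_<? j) L) ℕ.+ length (filter (j <?_) L) ℕ.+ cnt j L ≡ length L
length-split₃ j [] = refl
length-split₃ j (x ∷ L) with ℕP.<-cmp x j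
... | tri< x<j x≢j x≯j
  rewrite ListP.filter-accept (_<? j) {x} {L} x<j | ListP.filter-reject (j <?_) {x} {L} x≯j
        | ind-≢ (x≢j ∘ sym) = cong suc (length-split₃ j L)
... | tri≈ x≮j refl x≯j
  rewrite ListP.filter-reject (_<? j) {x} {L} x≮j | ListP.filter-reject (j <?_) {x} {L} x≯j
        | ind-refl x = trans (ℕP.+-suc _ _) (cong suc (length-split₃ j L))
... | tri> x≮j x≢j x>j
  rewrite ListP.filter-reject (_<? j) {x} {L} x≮j | ListP.filter-accept (j <?_) {x} {L} x>j
        | ind-≢ (x≢j ∘ sym) =
  trans (cong (ℕ._+ cnt j L) (ℕP.+-suc _ _)) (cong suc (length-split₃ j L))

length-ascDown : ∀ i L → length (ascDown i L) ≡ length L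
length-ascDown i L =
  trans (ListP.length-++ (filter (_<? i) L))
        (trans (cong (length (filter (_<? i) L) ℕ.+_) (ListP.length-map suc (filter (i ≤?_) L)))
               (length-split i L))

length-ascUp : ∀ i L → length (ascUp i L) ≡ suc (length L)
length-ascUp i L =
  trans (ListP.length-++-sucʳ (filter (_<? i) L) i _) (cong suc (length-ascDown i L))

length-ascI : ∀ j L → length (ascI (suc j) L) ℕ.+ cnt (suc j) L ≡ suc (length L)
length-ascI j L =
  trans (cong (ℕ._+ cnt (suc j) L)
              (trans (ListP.length-++-sucʳ below (suc j) (map suc above))
                     (cong suc (trans (ListP.length-++ below)
                                      (cong (length below ℕ.+_) (ListP.length-map suc above))))))
        (cong suc (length-split₃ (suc j) L))
  where
  below above : List ℕ
  below = filter (_<? suc j) L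
  above = filter (suc j <?_) L

ValidAsc : ℕ → GP → Set
ValidAsc n π = Sorted 0 (proj₂ π) × All (_< n) (proj₂ π)

-- All three insertion rules keep the entries of L below i+1 and append a
-- list sorted above i; such a concatenation is again valid.
valid-append : ∀ {n} i {L M} → Sorted 0 L → All (_< n) L → Sorted i M → All (_< suc n) M →
  Sorted 0 (filter (_<? suc i) L ++ M) × All (_< suc n) (filter (_<? suc i) L ++ M)
valid-append i {L} sL L<n sM M<1+n =
  sorted-++ (sorted-filter (_<? suc i) sL) (All.map ℕP.≤-pred (AllP.all-filter (_<? suc i) L)) z≤n sM
  , AllP.++⁺ (AllP.filter⁺ (_<? suc i) (All.map ℕP.m<n⇒m<1+n L<n)) M<1+n

shifted-bound : ∀ {n p} {P : Pred ℕ p} (P? : Decidable P) {L} →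
  All (_< n) L → All (_< suc n) (map suc (filter P? L))
shifted-bound P? L<n = AllP.map⁺ (All.map s≤s (AllP.filter⁺ P? L<n))

ascI-valid : ∀ n j L → j ≤ n → Sorted 0 L → All (_< n) L →
  Sorted 0 (ascI j L) × All (_< suc n) (ascI j L)
ascI-valid n zero    L _   sL L<n = sorted-weaken z≤n (sorted-map-suc sL) , AllP.map⁺ (All.map s≤s L<n)
ascI-valid n (suc j) L j<n sL L<n =
  valid-append j sL L<n
    (ℕP.n<1+n j ∷ sorted-map-suc (sorted-filter-above (suc j <?_) (ℕP.<-trans (ℕP.n<1+n j)) sL))
    (s≤s j<n ∷ shifted-bound (suc j <?_) L<n)

ascUp-valid : ∀ n i L → suc i ≤ n → Sorted 0 L → All (_< n) L →
  Sorted 0 (ascUp (suc i) L) × All (_< suc n) (ascUp (suc i) L)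
ascUp-valid n i L i<n sL L<n =
  valid-append i sL L<n
    (ℕP.n<1+n i ∷ sorted-map-suc (sorted-filter-above (suc i ≤?_) (λ i<a → i<a) sL))
    (s≤s i<n ∷ shifted-bound (suc i ≤?_) L<n)

ascDown-valid : ∀ n i L → suc i ≤ n → Sorted 0 L → All (_< n) L →
  Sorted 0 (ascDown (suc i) L) × All (_< suc n) (ascDown (suc i) L)
ascDown-valid n i L i<n sL L<n =
  valid-append i sL L<n
    (sorted-weaken (ℕP.n≤1+n i) (sorted-map-suc (sorted-filter-above (suc i ≤?_) (λ i<a → i<a) sL)))
    (shifted-bound (suc i ≤?_) L<n)

step-valid : ∀ n π → ValidAsc n π → All (ValidAsc (suc n)) (step (suc n) π)
step-valid n (w , L) (sL , L<n) =
  AllP.++⁺ (AllP.map⁺ (AllP.applyUpTo⁺₁ (λ j → j) (suc n)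
                         (λ j<1+n → ascI-valid n _ L (ℕP.≤-pred j<1+n) sL L<n)))
    (AllP.++⁺ (AllP.map⁺ (AllP.map⁺ (AllP.applyUpTo⁺₁ (λ i → i) n
                                       (λ i<n → ascUp-valid n _ L i<n sL L<n))))
              (AllP.map⁺ (AllP.map⁺ (AllP.applyUpTo⁺₁ (λ i → i) n
                                       (λ i<n → ascDown-valid n _ L i<n sL L<n)))))

GS-valid : ∀ m → All (ValidAsc (suc m)) (GS (suc m))
GS-valid zero    = ([] , []) ∷ []
GS-valid (suc m) = AllP.concat⁺ (AllP.map⁺ (All.map (step-valid (suc m) _) (GS-valid m)))

ascent-gaps : ∀ n L → Sorted 0 L → All (_≤ n) L →
  sum (map (λ y → cnt (suc y) L) (upTo n)) ≡ length L
ascent-gaps n L sL L≤n = begin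
    sum (map (λ y → cnt (suc y) L) (upTo n))
  ≡⟨ cong sum (ListP.map-∘ (upTo n)) ⟩
    sum (map (λ y → cnt y L) (map suc (upTo n)))
  ≡⟨ double-count L (map suc (upTo n)) ⟩
    sum (map (λ a → cnt a (map suc (upTo n))) L)
  ≡⟨ sum-ones (λ a → cnt a (map suc (upTo n))) (once (sorted-above sL) L≤n) ⟩
    length L
  ∎
  where
  open ≡-Reasoning
  once : ∀ {L} → All (0 <_) L → All (_≤ n) L → All (λ a → cnt a (map suc (upTo n)) ≡ 1) L
  once []                    []          = []
  once (s≤s {n = a} z≤n ∷ ps) (a<n ∷ qs) = trans (cnt-map-suc a (upTo n)) (cnt-upTo n a a<n) ∷ once ps qs

ascents≤ : ∀ m π → ValidAsc (suc m) π → nasc π ≤ m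
ascents≤ m (w , L) (sL , L<1+m) =
  subst (_≤ m) (ascent-gaps m L sL (All.map ℕP.≤-pred L<1+m))
        (subst (sum (map (λ y → cnt (suc y) L) (upTo m)) ≤_) (ListP.length-upTo m)
               (sum-≤-length (λ y → cnt (suc y) L) (λ y → sorted-cnt≤1 (suc y) sL) (upTo m)))

weight : GP → Poly
weight π = mono (nasc π) (nua π) (nda π)

genFun : List GP → Poly
genFun []       = zeroP
genFun (π ∷ πs) = weight π +P genFun πs

weight-≡ : ∀ π {k a b} → nasc π ≡ k → nua π ≡ a → nda π ≡ b → weight π ≈ mono k a b
weight-≡ π refl refl refl = ≈-refl

genFun-++ : ∀ πs ρs → genFun (πs ++ ρs) ≈ genFun πs +P genFun ρs
genFun-++ []       ρs = ⟨ (λ k a b → sym (ℤP.+-identityˡ (genFun ρs k a b))) ⟩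
genFun-++ (π ∷ πs) ρs = ⟨ (λ k a b →
  trans (cong (_+_ (weight π k a b)) (coeff (genFun-++ πs ρs) k a b))
        (sym (ℤP.+-assoc (weight π k a b) (genFun πs k a b) (genFun ρs k a b)))) ⟩

genFun-const : ∀ {A : Set} (g : A → GP) {M} → (∀ y → weight (g y) ≈ M) →
  ∀ ys → genFun (map g ys) ≈ (+ length ys) • M
genFun-const g g≈M []       = ⟨ (λ _ _ _ → refl) ⟩
genFun-const g {M} g≈M (y ∷ ys) =
  ≈-trans (+P-cong (g≈M y) (genFun-const g g≈M ys))
          ⟨ (λ k a b → one-more (M k a b) (+ length ys)) ⟩
  where
  one-more : ∀ (m l : ℤ) → m + l * m ≡ (+ 1 + l) * m
  one-more = solve-∀

genFun-two : ∀ {A : Set} (g : A → GP) (c : A → ℕ) {M₀ M₁} →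
  (∀ y → (c y ≡ 1 × weight (g y) ≈ M₀) ⊎ (c y ≡ 0 × weight (g y) ≈ M₁)) →
  ∀ ys → genFun (map g ys) ≈ (+ sum (map c ys)) • M₀ +P (+ length ys - + sum (map c ys)) • M₁
genFun-two g c weights []       = ⟨ (λ _ _ _ → refl) ⟩
genFun-two g c {M₀} {M₁} weights (y ∷ ys) with weights y
... | inj₁ (cy≡1 , gy≈M₀) rewrite cy≡1 =
  ≈-trans (+P-cong gy≈M₀ (genFun-two g c weights ys))
          ⟨ (λ k a b → add-M₀ (+ sum (map c ys)) (+ length ys) (M₀ k a b) (M₁ k a b)) ⟩
  where
  add-M₀ : ∀ (s l m₀ m₁ : ℤ) →
    m₀ + (s * m₀ + (l - s) * m₁) ≡ (+ 1 + s) * m₀ + ((+ 1 + l) - (+ 1 + s)) * m₁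
  add-M₀ = solve-∀
... | inj₂ (cy≡0 , gy≈M₁) rewrite cy≡0 =
  ≈-trans (+P-cong gy≈M₁ (genFun-two g c weights ys))
          ⟨ (λ k a b → add-M₁ (+ sum (map c ys)) (+ length ys) (M₀ k a b) (M₁ k a b)) ⟩
  where
  add-M₁ : ∀ (s l m₀ m₁ : ℤ) → m₁ + (s * m₀ + (l - s) * m₁) ≡ s * m₀ + ((+ 1 + l) - s) * m₁
  add-M₁ = solve-∀

length-map-suc-upTo : ∀ n → length (map suc (upTo n)) ≡ n
length-map-suc-upTo n = trans (ListP.length-map suc (upTo n)) (ListP.length-upTo n)

countB-insertAt : ∀ (p : Tile → Bool) j t w → countB p (insertAt j t w) ≡ countB p (t ∷ w)
countB-insertAt p zero    t w       = refl
countB-insertAt p (suc j) t []      = refl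
countB-insertAt p (suc j) t (x ∷ w) rewrite countB-insertAt p j t w with p x | p t
... | true  | true  = refl
... | true  | false = refl
... | false | true  = refl
... | false | false = refl

module Children (n : ℕ) (w : List Tile) (L : List ℕ) where

  k a b : ℕ
  k = length L
  a = countB isUp w
  b = countB isDown w

  M Mx Mxu Md : Poly
  M   = mono k a b
  Mx  = mono (suc k) a b
  Mxu = mono (suc k) (suc a) b
  Md  = mono k a (suc b)

  unmarked upArrow downArrow : ℕ → GP
  unmarked  j = insertAt j (suc n , none) w , ascI j L
  upArrow   i = insertAt (i ∸ 1) (suc n , up) w , ascUp i L
  downArrow i = insertAt (i ∸ 1) (suc n , down) w , ascDown i L

  gaps ups downs : List GP
  gaps  = map unmarked (upTo (suc n))
  ups   = map upArrow (map suc (upTo n))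
  downs = map downArrow (map suc (upTo n))

  arrows-up : ∀ j → countB isUp (insertAt j (suc n , none) w) ≡ a
  arrows-up j = countB-insertAt isUp j _ w

  arrows-down : ∀ j → countB isDown (insertAt j (suc n , none) w) ≡ b
  arrows-down j = countB-insertAt isDown j _ w

  gap-weight : Sorted 0 L → ∀ y → (cnt (suc y) L ≡ 1 × weight (unmarked (suc y)) ≈ M)
                                ⊎ (cnt (suc y) L ≡ 0 × weight (unmarked (suc y)) ≈ Mx)
  gap-weight sL y with cnt (suc y) L | length-ascI y L | sorted-cnt≤1 (suc y) sL
  ... | 0           | len | _ =
    inj₂ (refl , weight-≡ (unmarked (suc y)) (trans (sym (ℕP.+-identityʳ _)) len)
                          (arrows-up (suc y)) (arrows-down (suc y)))
  ... | 1           | len | _ =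
    inj₁ (refl , weight-≡ (unmarked (suc y)) (ℕP.suc-injective (trans (ℕP.+-comm 1 _) len))
                          (arrows-up (suc y)) (arrows-down (suc y)))
  ... | suc (suc _) | _   | s≤s ()

  -- Gap 0 and the k gaps in L keep k ascents, the other n - k gaps add one.
  gaps-genFun : Sorted 0 L → All (_< n) L → genFun gaps ≈ M +P ((+ k) • M +P (+ n - + k) • Mx)
  gaps-genFun sL L<n =
    +P-cong (weight-≡ (unmarked 0) (ListP.length-map suc L) refl refl)
      (≈-trans (≈-reflexive (cong genFun (trans (cong (map unmarked) (sym (ListP.map-upTo suc n)))
                                                (sym (ListP.map-∘ (upTo n))))))
      (≈-trans (genFun-two (unmarked ∘ suc) (λ y → cnt (suc y) L) (gap-weight sL) (upTo n))
               (≈-reflexive (cong₂ (λ s l → (+ s) • M +P (+ l - + s) • Mx)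
                                   (ascent-gaps n L sL (All.map ℕP.<⇒≤ L<n)) (ListP.length-upTo n)))))

  ups-genFun : genFun ups ≈ (+ n) • Mxu
  ups-genFun =
    ≈-trans (genFun-const upArrow up-weight (map suc (upTo n)))
            (≈-reflexive (cong (λ l → (+ l) • Mxu) (length-map-suc-upTo n)))
    where
    up-weight : ∀ i → weight (upArrow i) ≈ Mxu
    up-weight i = weight-≡ (upArrow i) (length-ascUp i L)
                    (countB-insertAt isUp (i ∸ 1) _ w) (countB-insertAt isDown (i ∸ 1) _ w)

  downs-genFun : genFun downs ≈ (+ n) • Md
  downs-genFun =
    ≈-trans (genFun-const downArrow down-weight (map suc (upTo n)))
            (≈-reflexive (cong (λ l → (+ l) • Md) (length-map-suc-upTo n)))
    where
    down-weight : ∀ i → weight (downArrow i) ≈ Md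
    down-weight i = weight-≡ (downArrow i) (length-ascDown i L)
                      (countB-insertAt isUp (i ∸ 1) _ w) (countB-insertAt isDown (i ∸ 1) _ w)

  children-genFun : Sorted 0 L → All (_< n) L → genFun (step (suc n) (w , L)) ≈ children n k a b
  children-genFun sL L<n = begin
      genFun (gaps ++ ups ++ downs)
    ≈⟨ ≈-trans (genFun-++ gaps (ups ++ downs)) (+P-cong (≈-refl {genFun gaps}) (genFun-++ ups downs)) ⟩
      genFun gaps +P (genFun ups +P genFun downs)
    ≈⟨ +P-cong (gaps-genFun sL L<n) (+P-cong ups-genFun downs-genFun) ⟩
      (M +P ((+ k) • M +P (+ n - + k) • Mx)) +P ((+ n) • Mxu +P (+ n) • Md)
    ≈⟨ ⟨ (λ k′ a′ b′ →
         collect (+ k) (+ n) (M k′ a′ b′) (Mx k′ a′ b′) (Mxu k′ a′ b′) (Md k′ a′ b′)) ⟩ ⟩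
      children n k a b
    ∎
    where
    open SetoidReasoning polySetoid
    collect : ∀ (k n m mx mxu md : ℤ) →
      (m + (k * m + (n - k) * mx)) + (n * mxu + n * md) ≡ (+ 1 + k) * m + n * md + (n - k) * mx + n * mxu
    collect = solve-∀

open Children using (children-genFun)

genFun-children : ∀ n πs → All (ValidAsc n) πs →
  genFun (concatMap (step (suc n)) πs) ≈ R n (genFun πs)
genFun-children n []             []                   = ≈-sym (R-zero n)
genFun-children n ((w , L) ∷ πs) ((sL , L<n) ∷ valid) = begin
    genFun (step (suc n) (w , L) ++ concatMap (step (suc n)) πs)
  ≈⟨ genFun-++ (step (suc n) (w , L)) _ ⟩
    genFun (step (suc n) (w , L)) +P genFun (concatMap (step (suc n)) πs)
  ≈⟨ +P-cong (≈-trans (children-genFun n w L sL L<n)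
                      (≈-sym (R-mono n (length L) (countB isUp w) (countB isDown w))))
             (genFun-children n πs valid) ⟩
    R n (weight (w , L)) +P R n (genFun πs)
  ≈⟨ R-+ n (weight (w , L)) (genFun πs) ⟨
    R n (genFun ((w , L) ∷ πs))
  ∎
  where open SetoidReasoning polySetoid

bit : Bool → ℕ
bit b = if b then 1 else 0

ind-bit : ∀ i j → ind i j ≡ bit ⌊ i ℕ.≟ j ⌋
ind-bit i j with i ℕ.≟ j
... | yes refl = ind-refl i
... | no i≢j   = ind-≢ i≢j

bit-∧ : ∀ x y → bit (x ∧ y) ≡ bit x ℕ.* bit y
bit-∧ true  y = sym (ℕP.*-identityˡ (bit y))
bit-∧ false y = refl

countB-∷ : ∀ {A : Set} (p : A → Bool) x xs → countB p (x ∷ xs) ≡ bit (p x) ℕ.+ countB p xs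
countB-∷ p x xs with p x
... | true  = refl
... | false = refl

matches : ℕ → ℕ → ℕ → GP → Bool
matches k a b π = ⌊ nasc π ℕ.≟ k ⌋ ∧ ⌊ nua π ℕ.≟ a ⌋ ∧ ⌊ nda π ℕ.≟ b ⌋

weight-matches : ∀ π k a b → weight π k a b ≡ + bit (matches k a b π)
weight-matches π k a b = begin
    + ind i k * + ind j a * + ind l b
  ≡⟨ cong (_* + ind l b) (ℤP.pos-* (ind i k) (ind j a)) ⟨
    + (ind i k ℕ.* ind j a) * + ind l b
  ≡⟨ ℤP.pos-* (ind i k ℕ.* ind j a) (ind l b) ⟨
    + (ind i k ℕ.* ind j a ℕ.* ind l b)
  ≡⟨ cong +_ (ℕP.*-assoc (ind i k) (ind j a) (ind l b)) ⟩
    + (ind i k ℕ.* (ind j a ℕ.* ind l b))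
  ≡⟨ cong +_ (cong₂ ℕ._*_ (ind-bit i k) (cong₂ ℕ._*_ (ind-bit j a) (ind-bit l b))) ⟩
    + (bit ⌊ i ℕ.≟ k ⌋ ℕ.* (bit ⌊ j ℕ.≟ a ⌋ ℕ.* bit ⌊ l ℕ.≟ b ⌋))
  ≡⟨ cong +_ (trans (cong (bit ⌊ i ℕ.≟ k ⌋ ℕ.*_) (sym (bit-∧ ⌊ j ℕ.≟ a ⌋ ⌊ l ℕ.≟ b ⌋)))
                    (sym (bit-∧ ⌊ i ℕ.≟ k ⌋ (⌊ j ℕ.≟ a ⌋ ∧ ⌊ l ℕ.≟ b ⌋)))) ⟩
    + bit (matches k a b π)
  ∎
  where
  open ≡-Reasoning
  i j l : ℕ
  i = nasc π
  j = nua π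
  l = nda π

genFun-count : ∀ πs k a b → genFun πs k a b ≡ + countB (matches k a b) πs
genFun-count []       k a b = refl
genFun-count (π ∷ πs) k a b =
  trans (cong₂ _+_ (weight-matches π k a b) (genFun-count πs k a b))
        (cong +_ (sym (countB-∷ (matches k a b) π πs)))

genFun-vanishes : ∀ πs {k} a b → All (λ π → nasc π ≢ k) πs → genFun πs k a b ≡ + 0
genFun-vanishes []       a b []            = refl
genFun-vanishes (π ∷ πs) a b (π≢k ∷ πs≢k) =
  cong₂ _+_ (cong (λ t → t * δ (nua π) a * δ (nda π) b) (δ-≢ π≢k)) (genFun-vanishes πs a b πs≢k)

Apoly-genFun : ∀ m → Apoly (suc m) ≈ genFun (GS (suc m))
Apoly-genFun m = ⟨ coeffs ⟩
  where
  coeffs : Apoly (suc m) ≈P genFun (GS (suc m))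
  coeffs k a b with k <? suc m
  ... | yes _   = sym (genFun-count (GS (suc m)) k a b)
  ... | no k≮1+m = sym (genFun-vanishes (GS (suc m)) a b
                          (All.map (λ {π} valid → ℕP.<⇒≢ (ℕP.≤-<-trans (ascents≤ m π valid)
                                                               (ℕP.≰⇒> (k≮1+m ∘ s≤s))))
                                   (GS-valid m)))

GS₁-genFun : genFun (GS 1) ≈ children 0 0 0 0
GS₁-genFun = ⟨ (λ k a b →
  only-root (mono 0 0 0 k a b) (mono 0 0 1 k a b) (mono 1 0 0 k a b) (mono 1 1 0 k a b)) ⟩
  where
  only-root : ∀ (m md mx mxu : ℤ) → m + + 0 ≡ + 1 * m + + 0 * md + (+ 0 - + 0) * mx + + 0 * mxu
  only-root = solve-∀

mainTheorem9 : (n : ℕ) →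
    Apoly (suc n) ≈P
    (oneP +P constP (+ n) *P (D +P (oneP +P U) *P X)) *P Apoly n
    +P (X -P X *P X) *P ∂x (Apoly n)
mainTheorem9 zero = coeff (begin
    Apoly 1            ≈⟨ Apoly-genFun 0 ⟩
    genFun (GS 1)      ≈⟨ GS₁-genFun ⟩
    children 0 0 0 0   ≈⟨ R-mono 0 0 0 0 ⟨
    R 0 (mono 0 0 0)   ≈⟨ R-cong 0 oneP≈mono ⟨
    R 0 (Apoly 0)      ∎)
  where open SetoidReasoning polySetoid
mainTheorem9 (suc m) = coeff (begin
    Apoly (suc (suc m))                   ≈⟨ Apoly-genFun (suc m) ⟩
    genFun (concatMap (step (suc (suc m))) (GS (suc m)))
                                          ≈⟨ genFun-children (suc m) (GS (suc m)) (GS-valid m) ⟩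
    R (suc m) (genFun (GS (suc m)))       ≈⟨ R-cong (suc m) (Apoly-genFun m) ⟨
    R (suc m) (Apoly (suc m))             ∎)
  where open SetoidReasoning polySetoid
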